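{- Let $G=(V,E)$ be a simple graph on $n$ vertices. For every edge $e$ and every $\pi\in\Pi$, $Q(e,\pi)=O(n^2)$ (with an absolute constant).
   Context: $\Pi$ denotes the set of all bijections $\pi:E\to\{1,\dots,|E|\}$ (ranks). Vertex oracle $\mathrm{VO}(v,\pi)$: let $e_1=(v,u_1),\dots,e_k=(v,u_k)$ be the edges incident to $v$ with $\pi(e_1)<\dots<\pi(e_k)$; for $i=1,\dots,k$, if $\mathrm{EO}(e_i,u_i,\pi)$ returns true then return true; after the loop return false. Edge oracle $\mathrm{EO}(e,u,\pi)$, $u$ an endpoint of $e$: if $\mathrm{EO}(e,u,\pi)$ has already been computed during the current execution of the top-level vertex oracle call, return the stored answer (making no further calls). Otherwise let $e_1=(u,w_1),\dots,e_k=(u,w_k)$ be the edges incident to $u$ with $\pi(e_i)<\pi(e)$ and $\pi(e_1)<\dots<\pi(e_k)$; for $i=1,\dots,k$, if $\mathrm{EO}(e_i,w_i,\pi)$ returns true then return false; after the loop return true. For $e\in E$, $v\in V$: $Q(e,v,\pi)$ is the number of times the edge oracle is called on $e$ (with either endpoint as second argument, counting calls answered from stored values) during the execution of $\mathrm{VO}(v,\pi)$, and $Q(e,\pi):=\sum_{v\in V}Q(e,v,\pi)$. -}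

module Defs where

open import Data.Nat using (ℕ; zero; suc; _<_; _≤_; _*_; s≤s; _+_)
open import Data.Nat.Properties using (<-≤-trans)
open import Data.Fin using (Fin; toℕ)
open import Data.Fin.Properties using (toℕ<n)
import Data.Fin.Properties as FinP
open import Data.Bool using (Bool; true; false; if_then_else_)
open import Data.Maybe using (Maybe; just; nothing)
open import Data.List using (List; []; _∷_; allFin; map; filter; length)
open import Data.Product using (Σ; _×_; _,_; proj₁; proj₂)
open import Relation.Nullary using (yes; no)
open import Relation.Nullary.Decidable using (⌊_⌋)
open import Relation.Binary.PropositionalEquality using (_≡_)
open import Function.Bundles using (_↔_; Inverse)
import Data.Nat as N
open import Data.Nat.ListAction using (sum)

record SimpleGraph (n : ℕ) : Set where
  field
    adj    : Fin n → Fin n → Bool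
    sym    : ∀ u v → adj u v ≡ adj v u
    irrefl : ∀ u → adj u u ≡ false

open SimpleGraph public

-- An edge {u,v} is represented canonically as the pair (u , v) with u < v.
Edge : {n : ℕ} → SimpleGraph n → Set
Edge {n} G = Σ (Fin n × Fin n) λ p → (toℕ (proj₁ p) < toℕ (proj₂ p)) × (adj G (proj₁ p) (proj₂ p) ≡ true)

ends : {n : ℕ} {G : SimpleGraph n} → Edge G → Fin n × Fin n
ends e = proj₁ e

-- A ranking π ∈ Π: a bijection from E to {0,…,|E|-1} (0-based ranks; m = |E|).
Ranking : {n : ℕ} → SimpleGraph n → ℕ → Set
Ranking G m = Edge G ↔ Fin m

-- The oracles, for a graph whose edges are listed by rank:
-- E r = endpoints of the edge of rank r.

module Oracle {n m : ℕ} (E : Fin m → Fin n × Fin n) where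

  _=ᵛ_ : Fin n → Fin n → Bool
  u =ᵛ v = ⌊ u FinP.≟ v ⌋

  incident : Fin n → Fin n × Fin n → Bool
  incident u (a , b) = (a =ᵛ u) Data.Bool.∨ (b =ᵛ u)

  other : Fin n → Fin n × Fin n → Fin n
  other u (a , b) = if a =ᵛ u then b else a

  -- memo table: entries (rank of e, endpoint u, stored answer of EO(e,u))
  Memo : Set
  Memo = List (ℕ × Fin n × Bool)

  lookupMemo : ℕ → Fin n → Memo → Maybe Bool
  lookupMemo r u [] = nothing
  lookupMemo r u ((r' , u' , b) ∷ ms) =
    if ⌊ r N.≟ r' ⌋ Data.Bool.∧ (u =ᵛ u') then just b else lookupMemo r u ms

  -- state: memo table and the log of ranks of all edge-oracle calls made
  -- (one entry per call, including calls answered from the memo table)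
  State : Set
  State = Memo × List (Fin m)

  logCall : Fin m → State → State
  logCall r (memo , calls) = memo , (r ∷ calls)

  mutual
    -- EO(e,u) for e of rank r; d is a bound with toℕ r < d guaranteeing
    -- termination (ranks strictly decrease along nested calls).
    eo : (d : ℕ) (r : Fin m) → toℕ r < d → Fin n → State → Bool × State
    eo zero r () u s
    eo (suc d) r (s≤s r≤d) u s with lookupMemo (toℕ r) u (proj₁ (logCall r s))
    ... | just b = b , logCall r s
    ... | nothing with eoLoop d r r≤d u (allFin m) (logCall r s)
    ...   | (b , (memo' , calls')) = b , (((toℕ r , u , b) ∷ memo') , calls')

    eoLoop : (d : ℕ) (r : Fin m) → toℕ r ≤ d → Fin n → List (Fin m) → State → Bool × State
    eoLoop d r r≤d u [] s = true , s
    eoLoop d r r≤d u (r' ∷ rs) s with toℕ r' N.<? toℕ r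
    ... | no _ = eoLoop d r r≤d u rs s
    ... | yes r'<r with incident u (E r')
    ...   | false = eoLoop d r r≤d u rs s
    ...   | true with eo d r' (<-≤-trans r'<r r≤d) (other u (E r')) s
    ...     | (true , s') = false , s'
    ...     | (false , s') = eoLoop d r r≤d u rs s'

  voLoop : Fin n → List (Fin m) → State → Bool × State
  voLoop v [] s = false , s
  voLoop v (r ∷ rs) s with incident v (E r)
  ... | false = voLoop v rs s
  ... | true with eo m r (toℕ<n r) (other v (E r)) s
  ...   | (true , s') = true , s'
  ...   | (false , s') = voLoop v rs s'

  vo : Fin n → Bool × State
  vo v = voLoop v (allFin m) ([] , [])

  Qv : Fin m → Fin n → ℕ
  Qv r v = length (filter (λ r' → toℕ r' N.≟ toℕ r) (proj₂ (proj₂ (vo v))))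

  Qtot : Fin m → ℕ
  Qtot r = sum (map (Qv r) (allFin n))

Q₁ : {n m : ℕ} (G : SimpleGraph n) (π : Ranking G m) → Edge G → Fin n → ℕ
Q₁ {n} {m} G π e v = Oracle.Qv {n} {m} (λ r → ends {G = G} (Inverse.from π r)) (Inverse.to π e) v

Q : {n m : ℕ} (G : SimpleGraph n) (π : Ranking G m) → Edge G → ℕ
Q {n} {m} G π e = Oracle.Qtot {n} {m} (λ r → ends {G = G} (Inverse.from π r)) (Inverse.to π e)

{-# OPTIONS --safe #-}
module Submission where

-- Fix the edge R = {a, c} and a vertex v. Apart from the top-level call, every call
-- EO(R, ·) made during VO(v) comes from the loop of the first, non-memoised evaluation
-- of some EO(f, x) with x ∈ {a, c} and f incident to x, and that loop calls EO(R, ·)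
-- at most once. Afterwards the answer of EO(f, x) is stored, so Q(R, v) ≤ 1 + deg a +
-- deg c ≤ 2n + 1, and summing over v gives Q(R) ≤ 3n². Formally, the potential
-- "calls to R so far + pairs (f, x) as above not yet memoised" grows by at most
-- [r = R] over any call EO(r, ·).

open import Defs hiding (sym)
open import Algebra.Properties.CommutativeSemigroup
  using (interchange)
import Axiom.UniquenessOfIdentityProofs as UIP
open import Data.Bool using (Bool; true; false; T; _∧_; _∨_)
import Data.Bool.Properties as Boolₚ
open import Data.Empty using (⊥-elim)
open import Data.Fin using (Fin; toℕ) renaming (zero to fzero; suc to fsuc)
import Data.Fin.Properties as Finₚ
open import Data.List using (List; []; _∷_; allFin; map; filter; length; lookup)
open import Data.List.Properties using (length-tabulate)
open import Data.List.Membership.Propositional using (_∈_)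
open import Data.List.Membership.Propositional.Properties
  using (∈-lookup; ∈-filter⁻; ∈-allFin)
open import Data.List.Relation.Unary.All as All using ()
open import Data.List.Relation.Unary.AllPairs using (_∷_)
open import Data.List.Relation.Unary.Any using (here; there)
open import Data.List.Relation.Unary.Unique.Propositional using (Unique)
import Data.List.Relation.Unary.Unique.Propositional.Properties as Uniqueₚ
open import Data.Maybe using (just; nothing; is-nothing)
open import Data.Nat using (ℕ; suc; _≤_; _<_; _*_; _+_; z≤n; s≤s)
import Data.Nat as ℕ
open import Data.Nat.ListAction using (sum)
open import Data.Nat.Properties
open import Data.Nat.Tactic.RingSolver using (solve-∀)
open import Data.Product using (_×_; _,_; proj₁; proj₂; ∃)
open import Data.Sum using (inj₁; inj₂)
open import Function.Bundles using (Inverse; Equivalence)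
open import Relation.Nullary using (¬_; yes; no; does)
open import Relation.Nullary.Decidable using (⌊_⌋; toWitness; fromWitness)
open import Relation.Nullary.Decidable.Core using (T?)
open import Relation.Binary.PropositionalEquality
  using (_≡_; _≢_; refl; sym; trans; cong; cong₂; subst; module ≡-Reasoning)

𝟙 : Bool → ℕ
𝟙 true  = 1
𝟙 false = 0

count : {A : Set} → (A → Bool) → List A → ℕ
count p xs = sum (map (λ x → 𝟙 (p x)) xs)

𝟙-∨ : ∀ a b → 𝟙 (a ∨ b) ≤ 𝟙 a + 𝟙 b
𝟙-∨ true  _ = s≤s z≤n
𝟙-∨ false _ = ≤-refl

sum-map-≤ : {A : Set} (f : A → ℕ) {B : ℕ} → (∀ x → f x ≤ B) →
            ∀ xs → sum (map f xs) ≤ length xs * B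
sum-map-≤ f f≤B []       = z≤n
sum-map-≤ f f≤B (x ∷ xs) = +-mono-≤ (f≤B x) (sum-map-≤ f f≤B xs)

module _ {A : Set} {p q : A → Bool} (p⇒q : ∀ x → T (p x) → T (q x)) where

  𝟙-mono : ∀ x → 𝟙 (p x) ≤ 𝟙 (q x)
  𝟙-mono x with p x | q x | p⇒q x
  ... | false | _     | _    = z≤n
  ... | true  | true  | _    = ≤-refl
  ... | true  | false | p⇒qx = ⊥-elim (p⇒qx _)

  count-mono : ∀ xs → count p xs ≤ count q xs
  count-mono []       = z≤n
  count-mono (x ∷ xs) = +-mono-≤ (𝟙-mono x) (count-mono xs)

  count-mono-< : ∀ {y xs} → y ∈ xs → ¬ T (p y) → T (q y) → count p xs < count q xs
  count-mono-< {y} {x ∷ xs} (here refl) ¬py qy with p y | q y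
  ... | false | true  = s≤s (count-mono xs)
  ... | true  | _     = ⊥-elim (¬py _)
  count-mono-< {xs = x ∷ xs} (there y∈xs) ¬py qy =
    subst (_≤ count q (x ∷ xs)) (+-suc (𝟙 (p x)) (count p xs))
          (+-mono-≤ (𝟙-mono x) (count-mono-< y∈xs ¬py qy))

count-const-false : {A : Set} (xs : List A) → count (λ _ → false) xs ≡ 0
count-const-false []       = refl
count-const-false (_ ∷ xs) = count-const-false xs

count≡length-filter : {A : Set} (p : A → Bool) (xs : List A) →
                      count p xs ≡ length (filter (λ x → T? (p x)) xs)
count≡length-filter p []       = refl
count≡length-filter p (x ∷ xs) with p x
... | true  = cong suc (count≡length-filter p xs)
... | false = count≡length-filter p xs

lookup-injective : {A : Set} {xs : List A} → Unique xs →
                   ∀ i j → lookup xs i ≡ lookup xs j → i ≡ j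
lookup-injective {xs = _ ∷ _} _          fzero    fzero    _  = refl
lookup-injective {xs = _ ∷ _} (x∉ ∷ _)   fzero    (fsuc j) eq = ⊥-elim (All.lookup x∉ (∈-lookup j) eq)
lookup-injective {xs = _ ∷ _} (x∉ ∷ _)   (fsuc i) fzero    eq = ⊥-elim (All.lookup x∉ (∈-lookup i) (sym eq))
lookup-injective {xs = _ ∷ _} (_ ∷ uniq) (fsuc i) (fsuc j) eq = cong fsuc (lookup-injective uniq i j eq)

count-≤-injective : {A : Set} {k : ℕ} (p : A → Bool) (h : A → Fin k) {xs : List A} →
                    Unique xs → (∀ {x y} → T (p x) → T (p y) → h x ≡ h y → x ≡ y) →
                    count p xs ≤ k
count-≤-injective p h {xs} uniq h-inj rewrite count≡length-filter p xs =
  Finₚ.injective⇒≤ {f = λ i → h (lookup chosen i)} λ {i} {j} eq →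
    lookup-injective (Uniqueₚ.filter⁺ p? uniq) i j (h-inj (chosen-p i) (chosen-p j) eq)
  where
  p? = λ x → T? (p x)
  chosen = filter p? xs
  chosen-p : ∀ i → T (p (lookup chosen i))
  chosen-p i = proj₂ (∈-filter⁻ p? {xs = xs} (∈-lookup i))

module CallCount {n m : ℕ} (E : Fin m → Fin n × Fin n) (R : Fin m) where
  open Oracle E

  =ᵛ⇒≡ : ∀ {x y} → T (x =ᵛ y) → x ≡ y
  =ᵛ⇒≡ = toWitness

  =ᵛ-refl : ∀ x → T (x =ᵛ x)
  =ᵛ-refl x = fromWitness refl

  incident-other : ∀ u P → T (incident (other u P) P)
  incident-other u (a , b) with a =ᵛ u
  ... | true  = Equivalence.from Boolₚ.T-∨ (inj₂ (=ᵛ-refl b))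
  ... | false = Equivalence.from Boolₚ.T-∨ (inj₁ (=ᵛ-refl a))

  isR : Fin m → Bool
  isR r = does (toℕ r ℕ.≟ toℕ R)

  isR⇒≡R : ∀ r → T (isR r) → r ≡ R
  isR⇒≡R r isR = Finₚ.toℕ-injective (≡ᵇ⇒≡ (toℕ r) (toℕ R) isR)

  callsToR : List (Fin m) → ℕ
  callsToR calls = length (filter (λ r → toℕ r ℕ.≟ toℕ R) calls)

  callsToR-∷ : ∀ r calls → callsToR (r ∷ calls) ≡ 𝟙 (isR r) + callsToR calls
  callsToR-∷ r calls with toℕ r ℕ.≡ᵇ toℕ R
  ... | true  = refl
  ... | false = refl

  -- EO(f, x) is a call the oracle may still have to evaluate, not just look up.
  pending : Memo → Fin n → Fin m → Bool
  pending memo x f = is-nothing (lookupMemo (toℕ f) x memo) ∧ incident x (E f)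

  Φrow : Memo → Fin n → ℕ
  Φrow memo x = count (pending memo x) (allFin m)

  Φ : Memo → ℕ
  Φ memo = Φrow memo (proj₁ (E R)) + Φrow memo (proj₂ (E R))

  cost : State → ℕ
  cost (memo , calls) = callsToR calls + Φ memo

  cost-logCall : ∀ r s → cost (logCall r s) ≡ cost s + 𝟙 (isR r)
  cost-logCall r (memo , calls) = begin
    callsToR (r ∷ calls) + Φ memo          ≡⟨ cong (_+ Φ memo) (callsToR-∷ r calls) ⟩
    𝟙 (isR r) + callsToR calls + Φ memo    ≡⟨ +-assoc (𝟙 (isR r)) _ _ ⟩
    𝟙 (isR r) + (callsToR calls + Φ memo)  ≡⟨ +-comm (𝟙 (isR r)) _ ⟩
    callsToR calls + Φ memo + 𝟙 (isR r)    ∎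
    where open ≡-Reasoning

  lookupMemo-∷-≢ : ∀ {k r} x u b memo → k ≢ r →
                   lookupMemo k x ((r , u , b) ∷ memo) ≡ lookupMemo k x memo
  lookupMemo-∷-≢ {k} {r} x u b memo k≢r with k ℕ.≟ r
  ... | yes k≡r = ⊥-elim (k≢r k≡r)
  ... | no _    = refl

  pending-∷ : ∀ k memo x f → T (pending (k ∷ memo) x f) → T (pending memo x f)
  pending-∷ (r , u , b) memo x f with ⌊ toℕ f ℕ.≟ r ⌋ ∧ (x =ᵛ u)
  ... | true  = λ ()
  ... | false = λ pend → pend

  pending-answered : ∀ r u b memo → ¬ T (pending ((toℕ r , u , b) ∷ memo) u r)
  pending-answered r u b memo with toℕ r ℕ.≟ toℕ r | u Finₚ.≟ u
  ... | yes _ | yes _ = λ ()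
  ... | no r≢r | _    = λ _ → r≢r refl
  ... | _ | no u≢u    = λ _ → u≢u refl

  pending-fresh : ∀ r u memo → lookupMemo (toℕ r) u memo ≡ nothing →
                  T (incident u (E r)) → T (pending memo u r)
  pending-fresh r u memo miss u∈r rewrite miss = u∈r

  module _ (r : Fin m) (u : Fin n) (b : Bool) (memo : Memo)
           (miss : lookupMemo (toℕ r) u memo ≡ nothing) (u∈r : T (incident u (E r))) where

    Φrow-∷ : ∀ x → Φrow ((toℕ r , u , b) ∷ memo) x + 𝟙 (x =ᵛ u) ≤ Φrow memo x
    Φrow-∷ x = drop (x =ᵛ u) refl
      where
      shrinks : ∀ f → T (pending ((toℕ r , u , b) ∷ memo) x f) → T (pending memo x f)
      shrinks = pending-∷ (toℕ r , u , b) memo x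
      drop : ∀ β → (x =ᵛ u) ≡ β → Φrow ((toℕ r , u , b) ∷ memo) x + 𝟙 β ≤ Φrow memo x
      drop false _ = subst (_≤ Φrow memo x) (sym (+-identityʳ _)) (count-mono shrinks (allFin m))
      drop true x=u with refl ← =ᵛ⇒≡ {x} (subst T (sym x=u) _) =
        subst (_≤ Φrow memo x) (+-comm 1 _)
          (count-mono-< shrinks (∈-allFin r) (pending-answered r u b memo) (pending-fresh r u memo miss u∈r))

    Φ-∷ : Φ ((toℕ r , u , b) ∷ memo) + 𝟙 (incident u (E R)) ≤ Φ memo
    Φ-∷ = begin
      Φrow memo′ a + Φrow memo′ c + 𝟙 ((a =ᵛ u) ∨ (c =ᵛ u))
        ≤⟨ +-monoʳ-≤ _ (𝟙-∨ (a =ᵛ u) (c =ᵛ u)) ⟩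
      Φrow memo′ a + Φrow memo′ c + (𝟙 (a =ᵛ u) + 𝟙 (c =ᵛ u))
        ≡⟨ interchange +-commutativeSemigroup (Φrow memo′ a) _ _ _ ⟩
      Φrow memo′ a + 𝟙 (a =ᵛ u) + (Φrow memo′ c + 𝟙 (c =ᵛ u))
        ≤⟨ +-mono-≤ (Φrow-∷ a) (Φrow-∷ c) ⟩
      Φ memo ∎
      where
      open ≤-Reasoning
      memo′ = (toℕ r , u , b) ∷ memo
      a = proj₁ (E R)
      c = proj₂ (E R)

  UnchangedFrom : ℕ → Memo → Memo → Set
  UnchangedFrom B memo memo′ = ∀ k x → B ≤ k → lookupMemo k x memo′ ≡ lookupMemo k x memo

  mutual
    eo-unchanged : ∀ d r (r<d : toℕ r < d) u s →
                   UnchangedFrom (suc (toℕ r)) (proj₁ s) (proj₁ (proj₂ (eo d r r<d u s)))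
    eo-unchanged (suc d) r (s≤s r≤d) u (memo , calls) k x r<k
      with lookupMemo (toℕ r) u memo
    ... | just _ = refl
    ... | nothing
      with eoLoop d r r≤d u (allFin m) (logCall r (memo , calls))
         | eoLoop-unchanged d r r≤d u (allFin m) (logCall r (memo , calls))
    ...   | b , memo′ , _ | unchanged =
      trans (lookupMemo-∷-≢ x u b memo′ (>⇒≢ r<k)) (unchanged k x (<⇒≤ r<k))

    eoLoop-unchanged : ∀ d r (r≤d : toℕ r ≤ d) u xs s →
                       UnchangedFrom (toℕ r) (proj₁ s) (proj₁ (proj₂ (eoLoop d r r≤d u xs s)))
    eoLoop-unchanged d r r≤d u []        s k x _ = refl
    eoLoop-unchanged d r r≤d u (r′ ∷ rs) s k x r≤k with toℕ r′ ℕ.<? toℕ r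
    ... | no _ = eoLoop-unchanged d r r≤d u rs s k x r≤k
    ... | yes r′<r with incident u (E r′)
    ...   | false = eoLoop-unchanged d r r≤d u rs s k x r≤k
    ...   | true
      with eo d r′ (<-≤-trans r′<r r≤d) (other u (E r′)) s
         | eo-unchanged d r′ (<-≤-trans r′<r r≤d) (other u (E r′)) s
    ...     | true  , _  | unchanged = unchanged k x (≤-trans r′<r r≤k)
    ...     | false , s′ | unchanged =
      trans (eoLoop-unchanged d r r≤d u rs s′ k x r≤k) (unchanged k x (≤-trans r′<r r≤k))

  count-isR-≤1 : count isR (allFin m) ≤ 1
  count-isR-≤1 = count-≤-injective isR (λ _ → fzero) (Uniqueₚ.allFin⁺ m)
    λ {f} {f′} isR-f isR-f′ _ → trans (isR⇒≡R f isR-f) (sym (isR⇒≡R f′ isR-f′))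

  -- The loop of EO(·, u) can only call EO(R, ·) when u is an endpoint of R.
  loopBudget : Fin n → List (Fin m) → ℕ
  loopBudget u = count (λ r → incident u (E R) ∧ isR r)

  isR-≤-loopBudget : ∀ u r → T (incident u (E r)) → 𝟙 (isR r) ≤ 𝟙 (incident u (E R) ∧ isR r)
  isR-≤-loopBudget u r u∈r with isR r in r=R
  ... | false = z≤n
  ... | true with refl ← isR⇒≡R r (subst T (sym r=R) _) =
    subst (λ β → 1 ≤ 𝟙 (β ∧ true)) (sym (Equivalence.to Boolₚ.T-≡ u∈r)) ≤-refl

  loopBudget-allFin : ∀ u → loopBudget u (allFin m) ≤ 𝟙 (incident u (E R))
  loopBudget-allFin u with incident u (E R)
  ... | true  = count-isR-≤1
  ... | false = ≤-reflexive (count-const-false (allFin m))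

  mutual
    eo-cost : ∀ d r (r<d : toℕ r < d) u s → T (incident u (E r)) →
              cost (proj₂ (eo d r r<d u s)) ≤ cost s + 𝟙 (isR r)
    eo-cost (suc d) r (s≤s r≤d) u (memo , calls) u∈r
      with lookupMemo (toℕ r) u memo in miss
    ... | just _ = ≤-reflexive (cost-logCall r (memo , calls))
    ... | nothing
      with eoLoop d r r≤d u (allFin m) (logCall r (memo , calls))
         | eoLoop-unchanged d r r≤d u (allFin m) (logCall r (memo , calls))
         | eoLoop-cost d r r≤d u (allFin m) (logCall r (memo , calls))
    ...   | b , memo′ , calls′ | unchanged | loop-cost = +-cancelʳ-≤ β _ _ (begin
      callsToR calls′ + Φ memo″ + β     ≡⟨ +-assoc (callsToR calls′) _ β ⟩
      callsToR calls′ + (Φ memo″ + β)   ≤⟨ +-monoʳ-≤ (callsToR calls′) (Φ-∷ r u b memo′ still-miss u∈r) ⟩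
      cost (memo′ , calls′)             ≤⟨ loop-cost ⟩
      cost (logCall r (memo , calls)) + loopBudget u (allFin m)
                                        ≤⟨ +-mono-≤ (≤-reflexive (cost-logCall r (memo , calls)))
                                                    (loopBudget-allFin u) ⟩
      cost (memo , calls) + 𝟙 (isR r) + β ∎)
      where
      open ≤-Reasoning
      β = 𝟙 (incident u (E R))
      memo″ = (toℕ r , u , b) ∷ memo′
      still-miss = trans (unchanged (toℕ r) u ≤-refl) miss

    eoLoop-cost : ∀ d r (r≤d : toℕ r ≤ d) u xs s →
                  cost (proj₂ (eoLoop d r r≤d u xs s)) ≤ cost s + loopBudget u xs
    eoLoop-cost d r r≤d u [] s = ≤-reflexive (sym (+-identityʳ _))
    eoLoop-cost d r r≤d u (r′ ∷ rs) s with toℕ r′ ℕ.<? toℕ r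
    ... | no _ = ≤-trans (eoLoop-cost d r r≤d u rs s) (+-monoʳ-≤ (cost s) (m≤n+m _ _))
    ... | yes r′<r with incident u (E r′) in u∈r′
    ...   | false = ≤-trans (eoLoop-cost d r r≤d u rs s) (+-monoʳ-≤ (cost s) (m≤n+m _ _))
    ...   | true
      with eo d r′ (<-≤-trans r′<r r≤d) (other u (E r′)) s
         | eo-cost d r′ (<-≤-trans r′<r r≤d) (other u (E r′)) s (incident-other u (E r′))
    ...     | true , _ | call-cost =
      ≤-trans call-cost (+-monoʳ-≤ (cost s) (≤-trans r′-budget (m≤m+n _ _)))
      where r′-budget = isR-≤-loopBudget u r′ (subst T (sym u∈r′) _)
    ...     | false , s′ | call-cost = begin
      cost (proj₂ (eoLoop d r r≤d u rs s′))     ≤⟨ eoLoop-cost d r r≤d u rs s′ ⟩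
      cost s′ + loopBudget u rs                ≤⟨ +-monoˡ-≤ _ call-cost ⟩
      cost s + 𝟙 (isR r′) + loopBudget u rs    ≤⟨ +-monoˡ-≤ _ (+-monoʳ-≤ (cost s) r′-budget) ⟩
      cost s + 𝟙 (incident u (E R) ∧ isR r′) + loopBudget u rs
                                               ≡⟨ +-assoc (cost s) _ _ ⟩
      cost s + loopBudget u (r′ ∷ rs)          ∎
      where open ≤-Reasoning
            r′-budget = isR-≤-loopBudget u r′ (subst T (sym u∈r′) _)

  voLoop-cost : ∀ v xs s → cost (proj₂ (voLoop v xs s)) ≤ cost s + count isR xs
  voLoop-cost v [] s = ≤-reflexive (sym (+-identityʳ _))
  voLoop-cost v (r ∷ rs) s with incident v (E r)
  ... | false = ≤-trans (voLoop-cost v rs s) (+-monoʳ-≤ (cost s) (m≤n+m _ _))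
  ... | true
    with eo m r (Finₚ.toℕ<n r) (other v (E r)) s
       | eo-cost m r (Finₚ.toℕ<n r) (other v (E r)) s (incident-other v (E r))
  ...   | true , _   | call-cost = ≤-trans call-cost (+-monoʳ-≤ (cost s) (m≤m+n _ _))
  ...   | false , s′ | call-cost = ≤-trans (voLoop-cost v rs s′)
      (≤-trans (+-monoˡ-≤ _ call-cost) (≤-reflexive (+-assoc (cost s) _ _)))

  Qv≤Φ[]+1 : ∀ v → Qv R v ≤ Φ [] + 1
  Qv≤Φ[]+1 v = begin
    callsToR calls                                ≤⟨ m≤m+n _ _ ⟩
    cost (memo , calls)                           ≤⟨ voLoop-cost v (allFin m) ([] , []) ⟩
    cost ([] , []) + count isR (allFin m)         ≤⟨ +-monoʳ-≤ (Φ []) count-isR-≤1 ⟩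
    Φ [] + 1                                      ∎
    where
    open ≤-Reasoning
    memo = proj₁ (proj₂ (vo v))
    calls = proj₂ (proj₂ (vo v))

  other-injective : ∀ x {P P′} → toℕ (proj₁ P) < toℕ (proj₂ P) → toℕ (proj₁ P′) < toℕ (proj₂ P′) →
                    T (incident x P) → T (incident x P′) → other x P ≡ other x P′ → P ≡ P′
  other-injective x {a , b} {a′ , b′} a<b a′<b′ x∈P x∈P′ eq
    with a Finₚ.≟ x | a′ Finₚ.≟ x
  ... | yes refl | yes refl = cong (a ,_) eq
  ... | yes refl | no _ with refl ← =ᵛ⇒≡ x∈P′ =
    ⊥-elim (<-asym a<b (subst (λ y → toℕ y < toℕ x) (sym eq) a′<b′))
  ... | no _ | yes refl with refl ← =ᵛ⇒≡ x∈P =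
    ⊥-elim (<-asym a′<b′ (subst (λ y → toℕ y < toℕ x) eq a<b))
  ... | no _ | no _ = cong₂ _,_ eq (trans (=ᵛ⇒≡ x∈P) (sym (=ᵛ⇒≡ x∈P′)))

  module _ (ordered : ∀ f → toℕ (proj₁ (E f)) < toℕ (proj₂ (E f)))
           (E-injective : ∀ {f f′} → E f ≡ E f′ → f ≡ f′) where

    degree-≤ : ∀ x → count (λ f → incident x (E f)) (allFin m) ≤ n
    degree-≤ x = count-≤-injective (λ f → incident x (E f)) (λ f → other x (E f))
      (Uniqueₚ.allFin⁺ m)
      λ {f} {f′} x∈f x∈f′ eq → E-injective (other-injective x (ordered f) (ordered f′) x∈f x∈f′ eq)

    Qv≤2n+1 : ∀ v → Qv R v ≤ suc (n + n)
    Qv≤2n+1 v = begin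
      Qv R v          ≤⟨ Qv≤Φ[]+1 v ⟩
      Φ [] + 1        ≤⟨ +-monoˡ-≤ 1 (+-mono-≤ (degree-≤ (proj₁ (E R))) (degree-≤ (proj₂ (E R)))) ⟩
      n + n + 1       ≡⟨ +-comm (n + n) 1 ⟩
      suc (n + n)     ∎
      where open ≤-Reasoning

ends-injective : ∀ {n} {G : SimpleGraph n} {e e′ : Edge G} → ends {G = G} e ≡ ends {G = G} e′ → e ≡ e′
ends-injective {e = P , P-ordered , P∈G} {.P , P-ordered′ , P∈G′} refl =
  cong₂ (λ o a → P , o , a) (<-irrelevant P-ordered P-ordered′)
        (UIP.Decidable⇒UIP.≡-irrelevant Boolₚ._≟_ P∈G P∈G′)

ranked-ends-injective : ∀ {n m} {G : SimpleGraph n} (π : Ranking G m) {f f′ : Fin m} →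
                        ends {G = G} (Inverse.from π f) ≡ ends {G = G} (Inverse.from π f′) → f ≡ f′
ranked-ends-injective {G = G} π {f} {f′} eq = begin
  f                                   ≡⟨ sym (Inverse.strictlyInverseˡ π f) ⟩
  Inverse.to π (Inverse.from π f)     ≡⟨ cong (Inverse.to π) (ends-injective {G = G} eq) ⟩
  Inverse.to π (Inverse.from π f′)    ≡⟨ Inverse.strictlyInverseˡ π f′ ⟩
  f′                                  ∎
  where open ≡-Reasoning

2n+1≤3n : ∀ {n} → 0 < n → suc (n + n) ≤ 3 * n
2n+1≤3n {n} 0<n = subst (suc (n + n) ≤_) (n+[n+n]≡3n n) (+-monoˡ-≤ (n + n) 0<n)
  where
  n+[n+n]≡3n : ∀ n → n + (n + n) ≡ 3 * n
  n+[n+n]≡3n = solve-∀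

Q₁≤3n : ∀ {n m} (G : SimpleGraph n) (π : Ranking G m) (e : Edge G) v → Q₁ G π e v ≤ 3 * n
Q₁≤3n G π e v = ≤-trans
  (CallCount.Qv≤2n+1 (λ r → ends {G = G} (Inverse.from π r)) (Inverse.to π e)
     (λ f → proj₁ (proj₂ (Inverse.from π f))) (ranked-ends-injective {G = G} π) v)
  (2n+1≤3n (≤-<-trans z≤n (Finₚ.toℕ<n v)))

mainTheorem6 : ∃ λ (C : ℕ) → ∀ (n m : ℕ) (G : SimpleGraph n) (π : Ranking G m) (e : Edge G)
    → Q G π e ≤ C * (n * n)
mainTheorem6 = 3 , λ n m G π e → begin
  Q G π e                      ≤⟨ sum-map-≤ (Q₁ G π e) (Q₁≤3n G π e) (allFin n) ⟩
  length (allFin n) * (3 * n)  ≡⟨ cong (_* (3 * n)) (length-tabulate {n = n} (λ v → v)) ⟩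
  n * (3 * n)                  ≡⟨ n*[3*n]≡3*[n*n] n ⟩
  3 * (n * n)                  ∎
  where
  open ≤-Reasoning
  n*[3*n]≡3*[n*n] : ∀ n → n * (3 * n) ≡ 3 * (n * n)
  n*[3*n]≡3*[n*n] = solve-∀
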